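{- Let $k \geq 0$ be an integer. Then $F(2k,k) \geq 2^{2^k}$.
   Context: $Q_n$ is the $n$-dimensional Boolean hypercube with vertex set $\{ -1,1\}^n$, two vertices being adjacent iff they differ in exactly one coordinate; $\Gamma(x)$ denotes the neighbourhood of $x$ ($Q_0$ has a single vertex). A Boolean function on $Q_n$ is a function $f:\{ -1,1\}^n\to\{ -1,1\}$. A $k$-function is a Boolean function $f$ on $Q_n$ such that for every vertex $v$, $|\{w\in\Gamma(v): f(v)\neq f(w)\}|=k$. $F(n,k)$ denotes the number of $k$-functions on $Q_n$. -}

module Defs where

open import Data.Bool using (Bool; true; false; not)
open import Data.Bool.Properties using () renaming (_≟_ to _≟B_)
open import Data.Nat using (ℕ; zero; suc; _+_)
open import Data.Nat.Properties using () renaming (_≟_ to _≟ℕ_)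
open import Data.Fin using (Fin)
open import Data.Vec using (Vec; []; _∷_; _[_]%=_)
open import Data.List using (List; []; _∷_; map; _++_; concatMap; length; filter; allFin)
open import Data.List.Relation.Unary.All using (All)
open import Data.List.Relation.Unary.All.Properties using ()
import Data.List.Relation.Unary.All as All
open import Relation.Nullary using (Dec; ¬_)
open import Relation.Nullary.Decidable using (¬?)
open import Relation.Binary.PropositionalEquality using (_≡_)

-- Vertices of Q_n: Vec Bool n (Bool encodes {-1,1}: true ↦ 1, false ↦ -1).
-- Boolean function on Q_n: Vec Bool n → Bool.

vertices : (n : ℕ) → List (Vec Bool n)
vertices zero    = [] ∷ []
vertices (suc n) = map (true ∷_) (vertices n) ++ map (false ∷_) (vertices n)

-- all 2^(2^n) Boolean functions on Q_n, each listed exactly once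
-- (as functions, distinct entries differ at some vertex)
functions : (n : ℕ) → List (Vec Bool n → Bool)
functions zero    = (λ _ → true) ∷ (λ _ → false) ∷ []
functions (suc n) =
  concatMap (λ g → map (λ h → combine g h) (functions n)) (functions n)
  where
  combine : (Vec Bool n → Bool) → (Vec Bool n → Bool) → Vec Bool (suc n) → Bool
  combine g h (true  ∷ x) = g x
  combine g h (false ∷ x) = h x

-- the neighbour of x obtained by flipping coordinate i; Γ(x) = { flip i x | i : Fin n }
flip : {n : ℕ} → Fin n → Vec Bool n → Vec Bool n
flip i x = x [ i ]%= not

disagree : {n : ℕ} → (Vec Bool n → Bool) → Vec Bool n → ℕ
disagree {n} f v = length (filter (λ i → ¬? (f v ≟B f (flip i v))) (allFin n))

IsKFunction : (n k : ℕ) → (Vec Bool n → Bool) → Set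
IsKFunction n k f = (v : Vec Bool n) → disagree f v ≡ k

isKFunction? : (n k : ℕ) → (f : Vec Bool n → Bool) → Dec (All (λ v → disagree f v ≡ k) (vertices n))
isKFunction? n k f = All.all? (λ v → disagree f v ≟ℕ k) (vertices n)

F : ℕ → ℕ → ℕ
F n k = length (filter (isKFunction? n k) (functions n))

-- To a Boolean function g on Q_k associate its twist, the function
-- f(x, y) = g(x ⊕ y) ⊕ parity(x) on Q_k × Q_k = Q_{2k}. Flipping the i-th coordinate of
-- x or the i-th coordinate of y changes x ⊕ y in the same way, but only the first changes
-- parity(x); hence exactly one of the two flips changes the value of f, so every vertex
-- has exactly k disagreeing neighbours. Since g(z) = f(z, 0) ⊕ parity(z), distinct g give
-- distinct k-functions, and there are 2^(2^k) functions g.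
module Submission where

open import Defs
open import Data.Nat using (ℕ; zero; suc; _+_; _*_; _^_; _≤_)
open import Data.Nat.Properties using (+-identityʳ; +-suc; ^-distribˡ-+-*)
open import Data.Bool using (Bool; true; false; not; _xor_)
open import Data.Bool.Properties
  using (not-distribˡ-xor; not-distribʳ-xor; xor-identityʳ; xor-assoc; xor-same) renaming (_≟_ to _≟B_)
open import Data.Fin using (Fin; zero; suc; _↑ˡ_; _↑ʳ_)
open import Data.Fin.Properties using (injective⇒≤) renaming (_≟_ to _≟F_)
open import Data.Vec using (Vec; []; _∷_; _++_; zipWith; replicate; take; drop)
open import Data.Vec.Properties using (take++drop≡id; ++-injective; zipWith-identityʳ)
open import Data.List using (List; []; _∷_; map; concatMap; length; filter; tabulate; lookup)
  renaming (_++_ to _++ᴸ_)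
open import Data.List.Properties using (length-map; length-++; filter-++)
open import Data.List.Membership.Propositional.Properties using (∈-lookup)
open import Data.List.Relation.Unary.Any using (Any; here; there; index)
import Data.List.Relation.Unary.Any as Any
import Data.List.Relation.Unary.Any.Properties as Anyₚ
open import Data.List.Relation.Unary.All using (All; []; _∷_)
import Data.List.Relation.Unary.All as All
import Data.List.Relation.Unary.All.Properties as Allₚ
open import Data.List.Relation.Unary.AllPairs using (AllPairs; []; _∷_)
import Data.List.Relation.Unary.AllPairs as AllPairs
import Data.List.Relation.Unary.AllPairs.Properties as AllPairsₚ
open import Data.Product using (_,_; proj₁; proj₂; _×_)
open import Data.Sum using (inj₁; inj₂)
open import Data.Empty using (⊥; ⊥-elim)
open import Function using (_∘_; id; case_of_)
open import Level using (0ℓ)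
open import Relation.Nullary using (Dec; yes; no; ¬_; does)
open import Relation.Nullary.Decidable using (¬?)
open import Relation.Unary using (Pred; Decidable)
open import Relation.Binary using (Symmetric)
open import Relation.Binary.PropositionalEquality

private
  variable
    A B : Set
    m n : ℕ

AllPairs-lookup : {R : A → A → Set} → Symmetric R → {xs : List A} → AllPairs R xs →
                  {i j : Fin (length xs)} → i ≢ j → R (lookup xs i) (lookup xs j)
AllPairs-lookup sym (_   ∷ _)   {zero}  {zero}  i≢j = ⊥-elim (i≢j refl)
AllPairs-lookup sym (Rx  ∷ _)   {zero}  {suc j} _   = All.lookup Rx (∈-lookup j)
AllPairs-lookup sym (Rx  ∷ _)   {suc i} {zero}  _   = sym (All.lookup Rx (∈-lookup i))
AllPairs-lookup sym (_   ∷ Rxs) {suc i} {suc j} i≢j = AllPairs-lookup sym Rxs (i≢j ∘ cong suc)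

module _ (R : A → B → Set) where

  Apart : A → A → Set
  Apart a a′ = ∀ {b} → R a b → R a′ b → ⊥

  length-≤-by-apart-witnesses : {xs : List A} {ys : List B} → AllPairs Apart xs →
                                All (λ a → Any (R a) ys) xs → length xs ≤ length ys
  length-≤-by-apart-witnesses {xs} {ys} apart witnessed = injective⇒≤ witness-injective
    where
    apart-sym : Symmetric Apart
    apart-sym a∦a′ Ra′b Rab = a∦a′ Rab Ra′b

    witness : (i : Fin (length xs)) → Any (R (lookup xs i)) ys
    witness i = All.lookup witnessed (∈-lookup i)

    witness-injective : ∀ {i j} → index (witness i) ≡ index (witness j) → i ≡ j
    witness-injective {i} {j} same with i ≟F j
    ... | yes i≡j = i≡j
    ... | no i≢j  = ⊥-elim (AllPairs-lookup apart-sym apart i≢j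
        (Anyₚ.lookup-index (witness i))
        (subst (R (lookup xs j) ∘ lookup ys) (sym same) (Anyₚ.lookup-index (witness j))))

tabulate-↑ : (f : Fin (m + n) → A) →
             tabulate f ≡ tabulate (f ∘ (_↑ˡ n)) ++ᴸ tabulate (f ∘ (m ↑ʳ_))
tabulate-↑ {zero}  f = refl
tabulate-↑ {suc m} f = cong (f zero ∷_) (tabulate-↑ {m} (f ∘ suc))

module _ {P : Pred A 0ℓ} (P? : Decidable P) where

  length-filter-tabulate-↑ : (f : Fin (m + n) → A) →
    length (filter P? (tabulate f)) ≡
    length (filter P? (tabulate (f ∘ (_↑ˡ n)))) + length (filter P? (tabulate (f ∘ (m ↑ʳ_))))
  length-filter-tabulate-↑ {m} {n} f = begin
    length (filter P? (tabulate f))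
      ≡⟨ cong (length ∘ filter P?) (tabulate-↑ {m} f) ⟩
    length (filter P? (tabulate (f ∘ (_↑ˡ n)) ++ᴸ tabulate (f ∘ (m ↑ʳ_))))
      ≡⟨ cong length (filter-++ P? (tabulate (f ∘ (_↑ˡ n))) _) ⟩
    length (filter P? (tabulate (f ∘ (_↑ˡ n))) ++ᴸ filter P? (tabulate (f ∘ (m ↑ʳ_))))
      ≡⟨ length-++ (filter P? (tabulate (f ∘ (_↑ˡ n)))) ⟩
    length (filter P? (tabulate (f ∘ (_↑ˡ n)))) + length (filter P? (tabulate (f ∘ (m ↑ʳ_))))
      ∎
    where open ≡-Reasoning

  length-filter-tabulate-complementary : (f g : Fin m → A) →
    (∀ i → does (P? (f i)) ≡ not (does (P? (g i)))) →
    length (filter P? (tabulate f)) + length (filter P? (tabulate g)) ≡ m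
  length-filter-tabulate-complementary {zero}  f g complementary = refl
  length-filter-tabulate-complementary {suc m} f g complementary
    with does (P? (f zero)) | does (P? (g zero)) | complementary zero
       | length-filter-tabulate-complementary (f ∘ suc) (g ∘ suc) (complementary ∘ suc)
  ... | true  | false | _ | ih = cong suc ih
  ... | false | true  | _ | ih = trans (+-suc _ _) (cong suc ih)

Any-filter⁺ : {P Q : Pred A 0ℓ} (Q? : Decidable Q) {xs : List A} →
              Any (λ x → P x × Q x) xs → Any P (filter Q? xs)
Any-filter⁺ Q? p with Anyₚ.filter⁺ Q? p
... | inj₁ q  = Any.map proj₁ q
... | inj₂ ¬Q = ⊥-elim (¬Q (proj₂ (Anyₚ.lookup-result p)))

flip-↑ˡ : (i : Fin m) (x : Vec Bool m) (y : Vec Bool n) → flip (i ↑ˡ n) (x ++ y) ≡ flip i x ++ y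
flip-↑ˡ zero    (a ∷ x) y = refl
flip-↑ˡ (suc i) (a ∷ x) y = cong (a ∷_) (flip-↑ˡ i x y)

flip-↑ʳ : (j : Fin n) (x : Vec Bool m) (y : Vec Bool n) → flip (m ↑ʳ j) (x ++ y) ≡ x ++ flip j y
flip-↑ʳ j []      y = refl
flip-↑ʳ j (a ∷ x) y = cong (a ∷_) (flip-↑ʳ j x y)

parity : Vec Bool n → Bool
parity []      = false
parity (a ∷ x) = a xor parity x

parity-flip : (i : Fin n) (x : Vec Bool n) → parity (flip i x) ≡ not (parity x)
parity-flip zero    (a ∷ x) = sym (not-distribˡ-xor a (parity x))
parity-flip (suc i) (a ∷ x) =
  trans (cong (a xor_) (parity-flip i x)) (sym (not-distribʳ-xor a (parity x)))

infixl 6 _⊕_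
_⊕_ : Vec Bool n → Vec Bool n → Vec Bool n
_⊕_ = zipWith _xor_

flip-⊕ˡ : (i : Fin n) (x y : Vec Bool n) → flip i x ⊕ y ≡ flip i (x ⊕ y)
flip-⊕ˡ zero    (a ∷ x) (b ∷ y) = cong (_∷ x ⊕ y) (sym (not-distribˡ-xor a b))
flip-⊕ˡ (suc i) (a ∷ x) (b ∷ y) = cong ((a xor b) ∷_) (flip-⊕ˡ i x y)

flip-⊕ʳ : (i : Fin n) (x y : Vec Bool n) → x ⊕ flip i y ≡ flip i (x ⊕ y)
flip-⊕ʳ zero    (a ∷ x) (b ∷ y) = cong (_∷ x ⊕ y) (sym (not-distribʳ-xor a b))
flip-⊕ʳ (suc i) (a ∷ x) (b ∷ y) = cong ((a xor b) ∷_) (flip-⊕ʳ i x y)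

does-≢ : (a b : Bool) → does (¬? (a ≟B b)) ≡ a xor b
does-≢ false false = refl
does-≢ false true  = refl
does-≢ true  false = refl
does-≢ true  true  = refl

disagree-complementary : (f : Vec Bool (m + m) → Bool) (x y : Vec Bool m) →
  (∀ i → f (x ++ y) xor f (flip i x ++ y) ≡ not (f (x ++ y) xor f (x ++ flip i y))) →
  disagree f (x ++ y) ≡ m
disagree-complementary {m} f x y complementary =
  -- `allFin (m + m)` in `disagree` is `tabulate id` by definition
  trans (length-filter-tabulate-↑ differs {m} id)
        (length-filter-tabulate-complementary differs (_↑ˡ m) (m ↑ʳ_) differs-complementary)
  where
  v = x ++ y

  differs : (i : Fin (m + m)) → Dec (¬ f v ≡ f (flip i v))
  differs i = ¬? (f v ≟B f (flip i v))

  differs-complementary : ∀ i → does (differs (i ↑ˡ m)) ≡ not (does (differs (m ↑ʳ i)))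
  differs-complementary i = begin
    does (differs (i ↑ˡ m))             ≡⟨ does-≢ (f v) _ ⟩
    f v xor f (flip (i ↑ˡ m) v)         ≡⟨ cong (λ w → f v xor f w) (flip-↑ˡ i x y) ⟩
    f v xor f (flip i x ++ y)           ≡⟨ complementary i ⟩
    not (f v xor f (x ++ flip i y))     ≡˘⟨ cong (λ w → not (f v xor f w)) (flip-↑ʳ i x y) ⟩
    not (f v xor f (flip (m ↑ʳ i) v))   ≡˘⟨ cong not (does-≢ (f v) _) ⟩
    not (does (differs (m ↑ʳ i)))       ∎
    where open ≡-Reasoning

record IsTwist (g : Vec Bool m → Bool) (f : Vec Bool (m + m) → Bool) : Set where
  constructor isTwist
  field
    twist-++ : (x y : Vec Bool m) → f (x ++ y) ≡ g (x ⊕ y) xor parity x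

twist : (Vec Bool m → Bool) → Vec Bool (m + m) → Bool
twist {m} g v = g (take m v ⊕ drop m v) xor parity (take m v)

twist-isTwist : (g : Vec Bool m → Bool) → IsTwist g (twist g)
twist-isTwist {m} g = isTwist twist-++
  where
  twist-++ : (x y : Vec Bool m) → twist g (x ++ y) ≡ g (x ⊕ y) xor parity x
  twist-++ x y with ++-injective (take m (x ++ y)) x (take++drop≡id m (x ++ y))
  ... | take≡x , drop≡y = cong₂ (λ x′ y′ → g (x′ ⊕ y′) xor parity x′) take≡x drop≡y

isTwist-complementary : {g : Vec Bool m → Bool} {f : Vec Bool (m + m) → Bool} → IsTwist g f →
  ∀ x y i → f (x ++ y) xor f (flip i x ++ y) ≡ not (f (x ++ y) xor f (x ++ flip i y))
isTwist-complementary {g = g} {f} (isTwist twisted) x y i = begin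
  u xor f (flip i x ++ y)         ≡⟨ cong (u xor_) (twisted (flip i x) y) ⟩
  u xor (g (flip i x ⊕ y) xor p′)
    ≡⟨ cong₂ (λ z q → u xor (g z xor q)) (flip-⊕ˡ i x y) (parity-flip i x) ⟩
  u xor (g z′ xor not p)          ≡˘⟨ cong (u xor_) (not-distribʳ-xor (g z′) p) ⟩
  u xor not (g z′ xor p)          ≡˘⟨ not-distribʳ-xor u _ ⟩
  not (u xor (g z′ xor p))        ≡˘⟨ cong (λ z → not (u xor (g z xor p))) (flip-⊕ʳ i x y) ⟩
  not (u xor (g (x ⊕ flip i y) xor p))
    ≡˘⟨ cong (λ w → not (u xor w)) (twisted x (flip i y)) ⟩
  not (u xor f (x ++ flip i y))   ∎
  where
  open ≡-Reasoning
  u  = f (x ++ y)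
  p  = parity x
  p′ = parity (flip i x)
  z′ = flip i (x ⊕ y)

isTwist-isKFunction : {g : Vec Bool m → Bool} {f : Vec Bool (m + m) → Bool} →
                      IsTwist g f → IsKFunction (m + m) m f
isTwist-isKFunction {m} {f = f} twisted v =
  subst (λ w → disagree f w ≡ m) (take++drop≡id m v)
        (disagree-complementary f x y (isTwist-complementary twisted x y))
  where
  x = take m v
  y = drop m v

isTwist-recover : {g : Vec Bool m → Bool} {f : Vec Bool (m + m) → Bool} → IsTwist g f →
                  ∀ z → g z ≡ f (z ++ replicate m false) xor parity z
isTwist-recover {m} {g} {f} (isTwist twisted) z = sym (begin
  f (z ++ o) xor p          ≡⟨ cong (_xor p) (twisted z o) ⟩
  (g (z ⊕ o) xor p) xor p   ≡⟨ xor-assoc (g (z ⊕ o)) p p ⟩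
  g (z ⊕ o) xor (p xor p)   ≡⟨ cong (g (z ⊕ o) xor_) (xor-same p) ⟩
  g (z ⊕ o) xor false       ≡⟨ xor-identityʳ _ ⟩
  g (z ⊕ o)                 ≡⟨ cong g (zipWith-identityʳ xor-identityʳ z) ⟩
  g z                       ∎)
  where
  open ≡-Reasoning
  o = replicate m false
  p = parity z

isTwist-unique : {g g′ : Vec Bool m → Bool} {f : Vec Bool (m + m) → Bool} →
                 IsTwist g f → IsTwist g′ f → g ≗ g′
isTwist-unique twisted twisted′ z = trans (isTwist-recover twisted z) (sym (isTwist-recover twisted′ z))

isTwist-resp-≗ : {g : Vec Bool m → Bool} {f f′ : Vec Bool (m + m) → Bool} →
                 f ≗ f′ → IsTwist g f′ → IsTwist g f
isTwist-resp-≗ f≗f′ (isTwist twisted) = isTwist (λ x y → trans (f≗f′ (x ++ y)) (twisted x y))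

-- `functions (suc n)` is `pairs (functions n) (functions n)` for a combining function that is
-- local to Defs, so it can only be referred to through its two defining equations.
module Pairing
  (c : (Vec Bool n → Bool) → (Vec Bool n → Bool) → Vec Bool (suc n) → Bool)
  (c-true  : ∀ g h x → c g h (true  ∷ x) ≡ g x)
  (c-false : ∀ g h x → c g h (false ∷ x) ≡ h x)
  where

  pairs : List (Vec Bool n → Bool) → List (Vec Bool n → Bool) → List (Vec Bool (suc n) → Bool)
  pairs gs hs = concatMap (λ g → map (c g) hs) gs

  length-pairs : (gs hs : List (Vec Bool n → Bool)) → length (pairs gs hs) ≡ length gs * length hs
  length-pairs []       hs = refl
  length-pairs (g ∷ gs) hs =
    trans (length-++ (map (c g) hs)) (cong₂ _+_ (length-map (c g) hs) (length-pairs gs hs))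

  pairs-complete : {fs : List (Vec Bool n → Bool)} → (∀ f → Any (_≗ f) fs) →
                   ∀ f → Any (_≗ f) (pairs fs fs)
  pairs-complete complete f =
    Anyₚ.concat⁺ (Anyₚ.map⁺ (Any.map (λ g≗ → Anyₚ.map⁺ (Any.map (glue g≗) h-witness)) g-witness))
    where
    g-witness = complete (f ∘ (true ∷_))
    h-witness = complete (f ∘ (false ∷_))

    glue : ∀ {g h} → g ≗ f ∘ (true ∷_) → h ≗ f ∘ (false ∷_) → c g h ≗ f
    glue {g} {h} g≗ h≗ (true  ∷ x) = trans (c-true  g h x) (g≗ x)
    glue {g} {h} g≗ h≗ (false ∷ x) = trans (c-false g h x) (h≗ x)

  pairs-distinct : {fs : List (Vec Bool n → Bool)} → AllPairs (λ g h → ¬ g ≗ h) fs →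
                   AllPairs (λ g h → ¬ g ≗ h) (pairs fs fs)
  pairs-distinct {fs} distinct =
    AllPairsₚ.concat⁺ (Allₚ.map⁺ (All.universal same-first fs))
                      (AllPairsₚ.map⁺ (AllPairs.map different-first distinct))
    where
    restrictˡ : ∀ {g g′ h h′} → c g h ≗ c g′ h′ → g ≗ g′
    restrictˡ {g} {g′} {h} {h′} e x =
      trans (sym (c-true g h x)) (trans (e (true ∷ x)) (c-true g′ h′ x))

    restrictʳ : ∀ {g g′ h h′} → c g h ≗ c g′ h′ → h ≗ h′
    restrictʳ {g} {g′} {h} {h′} e x =
      trans (sym (c-false g h x)) (trans (e (false ∷ x)) (c-false g′ h′ x))

    same-first : ∀ g → AllPairs (λ f f′ → ¬ f ≗ f′) (map (c g) fs)
    same-first g = AllPairsₚ.map⁺ (AllPairs.map (_∘ restrictʳ) distinct)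

    different-first : ∀ {g g′} → ¬ g ≗ g′ →
                      All (λ f → All (λ f′ → ¬ f ≗ f′) (map (c g′) fs)) (map (c g) fs)
    different-first g≉g′ =
      Allₚ.map⁺ (All.universal (λ _ → Allₚ.map⁺ (All.universal (λ _ → g≉g′ ∘ restrictˡ) fs)) fs)

length-functions : ∀ n → length (functions n) ≡ 2 ^ 2 ^ n
length-functions zero    = refl
length-functions (suc n) = begin
  length (functions (suc n))
    ≡⟨ Pairing.length-pairs _ (λ _ _ _ → refl) (λ _ _ _ → refl) (functions n) (functions n) ⟩
  length (functions n) * length (functions n)   ≡⟨ cong₂ _*_ (length-functions n) (length-functions n) ⟩
  2 ^ 2 ^ n * 2 ^ 2 ^ n                         ≡˘⟨ ^-distribˡ-+-* 2 (2 ^ n) (2 ^ n) ⟩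
  2 ^ (2 ^ n + 2 ^ n)                           ≡˘⟨ cong (λ e → 2 ^ (2 ^ n + e)) (+-identityʳ (2 ^ n)) ⟩
  2 ^ 2 ^ suc n                                 ∎
  where open ≡-Reasoning

functions-complete : ∀ n (f : Vec Bool n → Bool) → Any (_≗ f) (functions n)
functions-complete zero f with f [] in f[]≡
... | true  = here λ { [] → sym f[]≡ }
... | false = there (here λ { [] → sym f[]≡ })
functions-complete (suc n) =
  Pairing.pairs-complete _ (λ _ _ _ → refl) (λ _ _ _ → refl) (functions-complete n)

functions-distinct : ∀ n → AllPairs (λ g h → ¬ g ≗ h) (functions n)
functions-distinct zero    = ((λ e → case e [] of λ ()) ∷ []) ∷ [] ∷ []
functions-distinct (suc n) =
  Pairing.pairs-distinct _ (λ _ _ _ → refl) (λ _ _ _ → refl) (functions-distinct n)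

2^2^k≤F[k+k,k] : ∀ k → 2 ^ 2 ^ k ≤ F (k + k) k
2^2^k≤F[k+k,k] k =
  subst (_≤ F (k + k) k) (length-functions k) (length-≤-by-apart-witnesses IsTwist apart witnesses)
  where
  apart : AllPairs (Apart IsTwist) (functions k)
  apart = AllPairs.map (λ g≉g′ {_} twisted twisted′ → g≉g′ (isTwist-unique twisted twisted′))
                       (functions-distinct k)

  kFunction-twist : ∀ g {f} → f ≗ twist g →
                    IsTwist g f × All (λ v → disagree f v ≡ k) (vertices (k + k))
  kFunction-twist g f≗ = twisted , All.universal (isTwist-isKFunction twisted) _
    where twisted = isTwist-resp-≗ f≗ (twist-isTwist g)

  witnesses : All (λ g → Any (IsTwist g) (filter (isKFunction? (k + k) k) (functions (k + k))))
                  (functions k)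
  witnesses = All.universal (λ g → Any-filter⁺ (isKFunction? (k + k) k)
    (Any.map (kFunction-twist g) (functions-complete (k + k) (twist g)))) _

corollary2 : (k : ℕ) → 2 ^ (2 ^ k) ≤ F (2 * k) k
corollary2 k = subst (λ n → 2 ^ 2 ^ k ≤ F (k + n) k) (sym (+-identityʳ k)) (2^2^k≤F[k+k,k] k)
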